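{- Let $\mathbf I=(i_0,i_1,\ldots,i_f,0,0,\ldots)$ be an eventually zero sequence of nonnegative integers, not identically zero, with last nonzero entry $i_f$ (so $f$ is its degree), and with $-1+\sum_k i_k=2n$ even. For $0\le k\le f$ put $S_k=\sum_{m=0}^{k}(-1)^{k-m}i_m=i_k-i_{k-1}+i_{k-2}-\cdots+(-1)^k i_0$. Then $\mathbf I$ is the frame of some Dyck path if and only if: (i) $i_0=1$ if $f=0$, and $i_0\ge 2$ if $f>0$; (ii) for every $k$ with $1\le k\le f-1$: $S_k\ge 0$ if $k$ is odd and $S_k\ge 2$ if $k$ is even; (iii) $S_f=-1$ if $f$ is odd and $S_f=1$ if $f$ is even.
   Context: A Dyck path of length $2n$ is a lattice path from $(0,0)$ to $(2n,0)$ with steps $(1,1)$, $(1,-1)$ never going below the $x$-axis. The frame of a Dyck path is the eventually zero sequence $(i_0,i_1,\ldots)$ where $i_k$ is the number of vertices of the path (including endpoints) at height $k$. -}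

module Defs where

open import Data.Bool using (Bool; true; false; if_then_else_)
open import Data.Nat using (ℕ; zero; suc; _+_; _*_; _<_)
open import Data.Integer as ℤ using (ℤ; +_; _-_; _≤_; +0)
open import Data.List using (List; []; _∷_)
open import Data.List.Relation.Unary.All using (All)
open import Data.Product using (Σ; ∃; _×_)
open import Relation.Binary.PropositionalEquality using (_≡_)
open import Relation.Nullary using (does)

-- A step of a lattice path: true = up step (1,1), false = down step (1,-1).
Step : Set
Step = Bool

heightsFrom : ℤ → List Step → List ℤ
heightsFrom h []           = h ∷ []
heightsFrom h (true  ∷ ss) = h ∷ heightsFrom (h ℤ.+ ℤ.+ 1) ss
heightsFrom h (false ∷ ss) = h ∷ heightsFrom (h - ℤ.+ 1) ss

endHeight : ℤ → List Step → ℤ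
endHeight h []           = h
endHeight h (true  ∷ ss) = endHeight (h ℤ.+ ℤ.+ 1) ss
endHeight h (false ∷ ss) = endHeight (h - ℤ.+ 1) ss

IsDyck : List Step → Set
IsDyck p = All (λ h → +0 ≤ h) (heightsFrom +0 p) × endHeight +0 p ≡ +0

countHeight : ℕ → List ℤ → ℕ
countHeight k []       = 0
countHeight k (h ∷ hs) = if does (h ℤ.≟ + k) then suc (countHeight k hs) else countHeight k hs

frame : List Step → ℕ → ℕ
frame p k = countHeight k (heightsFrom +0 p)

IsFrameOfDyck : (ℕ → ℕ) → Set
IsFrameOfDyck I = Σ (List Step) λ p → IsDyck p × (∀ k → frame p k ≡ I k)

sumUpTo : (ℕ → ℕ) → ℕ → ℕ
sumUpTo I zero    = I 0
sumUpTo I (suc m) = sumUpTo I m + I (suc m)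

-- S_k = Σ_{m=0}^{k} (-1)^{k-m} i_m , via S_0 = i_0, S_{k+1} = i_{k+1} - S_k
S : (ℕ → ℕ) → ℕ → ℤ
S I zero    = + I 0
S I (suc k) = + I (suc k) - S I k

Even : ℕ → Set
Even k = ∃ λ m → k ≡ 2 * m

Odd : ℕ → Set
Odd k = ∃ λ m → k ≡ suc (2 * m)

module Submission where

-- For a path p and a height k let e k be the number of steps of p joining
-- heights k and k+1.  Each vertex has two incident steps except the two
-- endpoints, so counting step-ends at height k gives the handshake identity
--   2 · #(vertices at k) = e (k-1) + e k + [start = k] + [end = k].
-- For a Dyck path with frame I this reads 2 I₀ = 2 + e₀ and
-- 2 I_{k+1} = e_k + e_{k+1}, which forces e_k = 2 T_k where
-- T₀ = I₀ - 1, T_{k+1} = I_{k+1} - T_k  (so T_k = S_k - (-1)^k).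
-- Necessity: a Dyck path reaching height f crosses every strip below f
-- (discrete intermediate value theorem), so T_k ≥ 1 for k < f, and it never
-- crosses the strip [f, f+1], so T_f = 0.
-- Sufficiency: the "tower" which climbs straight to height f and, on the
-- way down, makes T_k - 1 extra round trips through each strip [k, k+1],
-- has crossing numbers 2 T_k; since a frame is determined by T, its frame is I.
-- Finally the conditions (i)-(iii) on S are exactly T_k ≥ 1 (k < f), T_f = 0.

open import Defs
open import Data.Nat using (ℕ; zero; suc; _+_; _*_; _<_; _≤_)
open import Data.Integer using (+_; -[1+_])
open import Data.Product using (_×_)
open import Relation.Binary.PropositionalEquality using (_≡_; _≢_)
open import Function.Bundles using (_⇔_)

open import Data.Bool using (true; false; if_then_else_)
open import Data.Nat using (z≤n; s≤s; pred; _∸_)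
import Data.Nat.Properties as ℕP
open import Data.Nat.Tactic.RingSolver using (solve-∀)
open import Data.Integer as ℤ using (ℤ)
import Data.Integer.Properties as ℤP
import Data.Integer.Tactic.RingSolver as ℤSolver
open import Data.List using (List; []; _∷_; _++_)
open import Data.List.Relation.Unary.All as All using (All; []; _∷_)
open import Data.List.Relation.Unary.Any as Any using (Any; here; there)
open import Data.Product using (_,_; proj₂)
open import Data.Sum using (_⊎_; inj₁; inj₂)
open import Data.Empty using (⊥-elim)
open import Function using (_∘_)
open import Function.Bundles using (mk⇔; Equivalence)
open import Relation.Binary.PropositionalEquality
  using (refl; sym; trans; cong; cong₂; subst; subst₂; module ≡-Reasoning)
open import Relation.Nullary using (yes; no; does)

open ≡-Reasoning
open Equivalence using (to; from)

+-sub-cancel : ∀ a c → (a ℤ.+ c) ℤ.- c ≡ a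
+-sub-cancel = ℤSolver.solve-∀

sub-+-cancel : ∀ a c → (a ℤ.- c) ℤ.+ c ≡ a
sub-+-cancel = ℤSolver.solve-∀

+-shift-≤ : ∀ c {a b} → (a ℤ.≤ b) ⇔ (a ℤ.+ c ℤ.≤ b ℤ.+ c)
+-shift-≤ c {a} {b} = mk⇔ (ℤP.+-monoˡ-≤ c)
  (λ le → subst₂ ℤ._≤_ (+-sub-cancel a c) (+-sub-cancel b c) (ℤP.+-monoˡ-≤ (ℤ.- c) le))

+-shift-≡ : ∀ c {a b} → (a ≡ b) ⇔ (a ℤ.+ c ≡ b ℤ.+ c)
+-shift-≡ c {a} {b} = mk⇔ (cong (ℤ._+ c))
  (λ eq → trans (sym (+-sub-cancel a c)) (trans (cong (ℤ._- c) eq) (+-sub-cancel b c)))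

δ : ℤ → ℤ → ℕ
δ a b = if does (a ℤ.≟ b) then 1 else 0

δ-≡ : ∀ {a b} → a ≡ b → δ a b ≡ 1
δ-≡ {a} {b} a≡b with a ℤ.≟ b
... | yes _   = refl
... | no a≢b = ⊥-elim (a≢b a≡b)

δ-≢ : ∀ {a b} → a ≢ b → δ a b ≡ 0
δ-≢ {a} {b} a≢b with a ℤ.≟ b
... | yes a≡b = ⊥-elim (a≢b a≡b)
... | no _    = refl

δ-shift : ∀ c a b → δ (a ℤ.+ c) (b ℤ.+ c) ≡ δ a b
δ-shift c a b with a ℤ.≟ b
... | yes refl = δ-≡ {a ℤ.+ c} refl
... | no a≢b  = δ-≢ (a≢b ∘ from (+-shift-≡ c))

countHeight-∷ : ∀ k h hs → countHeight k (h ∷ hs) ≡ δ h (+ k) + countHeight k hs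
countHeight-∷ k h hs with does (h ℤ.≟ + k)
... | true  = refl
... | false = refl

-- crossings z h p: the number of steps of p, started at height h, joining
-- heights z and z + 1.
crossings : ℤ → ℤ → List Step → ℕ
crossings z h []           = 0
crossings z h (true  ∷ ss) = δ h z + crossings z (h ℤ.+ + 1) ss
crossings z h (false ∷ ss) = δ (h ℤ.- + 1) z + crossings z (h ℤ.- + 1) ss

-- Handshake identity: every vertex at height k is incident to two steps in the
-- strips [k-1, k] and [k, k+1], except that the endpoints have only one.
handshake : ∀ k h p → 2 * countHeight k (heightsFrom h p) ≡
  crossings (+ k ℤ.- + 1) h p + crossings (+ k) h p + δ h (+ k) + δ (endHeight h p) (+ k)
handshake k h [] = trans (cong (2 *_) (countHeight-∷ k h [])) (regroup (δ h (+ k)))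
  where
  regroup : ∀ d → 2 * (d + 0) ≡ 0 + 0 + d + d
  regroup = solve-∀
handshake k h (true ∷ ss) = begin
  2 * countHeight k (h ∷ heightsFrom h′ ss)       ≡⟨ cong (2 *_) (countHeight-∷ k h (heightsFrom h′ ss)) ⟩
  2 * (d + countHeight k (heightsFrom h′ ss))     ≡⟨ ℕP.*-distribˡ-+ 2 d _ ⟩
  2 * d + 2 * countHeight k (heightsFrom h′ ss)   ≡⟨ cong (_+_ (2 * d)) (handshake k h′ ss) ⟩
  2 * d + (A + B + δ h′ (+ k) + z)                ≡⟨ cong (λ x → 2 * d + (A + B + x + z)) δ-up ⟩
  2 * d + (A + B + δ h (+ k ℤ.- + 1) + z)         ≡⟨ regroup d A B _ z ⟩
  (δ h (+ k ℤ.- + 1) + A) + (d + B) + d + z       ∎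
  where
  h′ = h ℤ.+ + 1
  d = δ h (+ k)
  A = crossings (+ k ℤ.- + 1) h′ ss
  B = crossings (+ k) h′ ss
  z = δ (endHeight h′ ss) (+ k)
  δ-up : δ h′ (+ k) ≡ δ h (+ k ℤ.- + 1)
  δ-up = trans (cong (δ h′) (sym (sub-+-cancel (+ k) (+ 1)))) (δ-shift (+ 1) h (+ k ℤ.- + 1))
  regroup : ∀ d A B x z → 2 * d + (A + B + x + z) ≡ (x + A) + (d + B) + d + z
  regroup = solve-∀
handshake k h (false ∷ ss) = begin
  2 * countHeight k (h ∷ heightsFrom h′ ss)       ≡⟨ cong (2 *_) (countHeight-∷ k h (heightsFrom h′ ss)) ⟩
  2 * (d + countHeight k (heightsFrom h′ ss))     ≡⟨ ℕP.*-distribˡ-+ 2 d _ ⟩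
  2 * d + 2 * countHeight k (heightsFrom h′ ss)   ≡⟨ cong (_+_ (2 * d)) (handshake k h′ ss) ⟩
  2 * d + (A + B + δ h′ (+ k) + z)                ≡⟨ regroup d A B _ z ⟩
  (d + A) + (δ h′ (+ k) + B) + d + z              ≡⟨ cong (λ x → (x + A) + (δ h′ (+ k) + B) + d + z)
                                                        (sym (δ-shift (ℤ.- + 1) h (+ k))) ⟩
  (δ h′ (+ k ℤ.- + 1) + A) + (δ h′ (+ k) + B) + d + z ∎
  where
  h′ = h ℤ.- + 1
  d = δ h (+ k)
  A = crossings (+ k ℤ.- + 1) h′ ss
  B = crossings (+ k) h′ ss
  z = δ (endHeight h′ ss) (+ k)
  regroup : ∀ d A B x z → 2 * d + (A + B + x + z) ≡ (d + A) + (x + B) + d + z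
  regroup = solve-∀

head-heights : ∀ {P : ℤ → Set} h p → All P (heightsFrom h p) → P h
head-heights h []          (ph ∷ _) = ph
head-heights h (true ∷ _)  (ph ∷ _) = ph
head-heights h (false ∷ _) (ph ∷ _) = ph

-- Every step through the strip [z, z+1] has an endpoint at height z, so a path
-- avoiding height z has no such step.
crossings-avoid : ∀ z h p → All (_≢ z) (heightsFrom h p) → crossings z h p ≡ 0
crossings-avoid z h []           _             = refl
crossings-avoid z h (true  ∷ ss) (h≢z ∷ rest) =
  cong₂ _+_ (δ-≢ h≢z) (crossings-avoid z (h ℤ.+ + 1) ss rest)
crossings-avoid z h (false ∷ ss) (_ ∷ rest)   =
  cong₂ _+_ (δ-≢ (head-heights (h ℤ.- + 1) ss rest)) (crossings-avoid z (h ℤ.- + 1) ss rest)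

crossing-exists : ∀ z h p → h ℤ.≤ z → Any (z ℤ.<_) (heightsFrom h p) → 1 ≤ crossings z h p
crossing-exists z h []          h≤z (here z<h) = ⊥-elim (ℤP.<⇒≱ z<h h≤z)
crossing-exists z h (true ∷ _)  h≤z (here z<h) = ⊥-elim (ℤP.<⇒≱ z<h h≤z)
crossing-exists z h (false ∷ _) h≤z (here z<h) = ⊥-elim (ℤP.<⇒≱ z<h h≤z)
crossing-exists z h (true ∷ ss) h≤z (there later) with h ℤ.≟ z
... | yes _   = s≤s z≤n
... | no h≢z = ℕP.≤-trans (crossing-exists z (h ℤ.+ + 1) ss h+1≤z later) (ℕP.m≤n+m _ _)
  where
  h+1≤z : h ℤ.+ + 1 ℤ.≤ z
  h+1≤z = subst (ℤ._≤ z) (ℤP.+-comm (+ 1) h) (ℤP.i<j⇒suc[i]≤j (ℤP.≤∧≢⇒< h≤z h≢z))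
crossing-exists z h (false ∷ ss) h≤z (there later) =
  ℕP.≤-trans (crossing-exists z (h ℤ.- + 1) ss h-1≤z later) (ℕP.m≤n+m _ _)
  where
  h-1≤z : h ℤ.- + 1 ℤ.≤ z
  h-1≤z = subst (ℤ._≤ z) (ℤP.+-comm (ℤ.- + 1) h) (ℤP.i≤j⇒pred[i]≤j h≤z)

countHeight-visited : ∀ k hs → countHeight k hs ≢ 0 → Any (_≡ + k) hs
countHeight-visited k []       count≢0 = ⊥-elim (count≢0 refl)
countHeight-visited k (h ∷ hs) count≢0 with h ℤ.≟ + k
... | yes h≡k = here h≡k
... | no _    = there (countHeight-visited k hs count≢0)

dyck-frame-zero : ∀ p → IsDyck p → 2 * frame p 0 ≡ 2 + crossings (+ 0) (+ 0) p
dyck-frame-zero p (nonneg , returns) = begin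
  2 * frame p 0                                            ≡⟨ handshake 0 (+ 0) p ⟩
  crossings -[1+ 0 ] (+ 0) p + e₀ + δ (+ 0) (+ 0) + δ (endHeight (+ 0) p) (+ 0)
    ≡⟨ cong₂ (λ x y → x + e₀ + 1 + y) no-negative-crossings (δ-≡ returns) ⟩
  0 + e₀ + 1 + 1                                           ≡⟨ regroup e₀ ⟩
  2 + e₀                                                   ∎
  where
  regroup : ∀ e → 0 + e + 1 + 1 ≡ 2 + e
  regroup = solve-∀
  e₀ = crossings (+ 0) (+ 0) p
  no-negative-crossings : crossings -[1+ 0 ] (+ 0) p ≡ 0
  no-negative-crossings = crossings-avoid -[1+ 0 ] (+ 0) p (All.map (λ { (ℤ.+≤+ _) () }) nonneg)

dyck-frame-suc : ∀ p → IsDyck p → ∀ k →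
  2 * frame p (suc k) ≡ crossings (+ k) (+ 0) p + crossings (+ suc k) (+ 0) p
dyck-frame-suc p (_ , returns) k = begin
  2 * frame p (suc k)                                       ≡⟨ handshake (suc k) (+ 0) p ⟩
  eₖ + eₖ₊₁ + δ (+ 0) (+ suc k) + δ (endHeight (+ 0) p) (+ suc k)
    ≡⟨ cong₂ (λ x y → eₖ + eₖ₊₁ + x + y) (δ-≢ {+ 0} {+ suc k} λ ()) (δ-≢ (λ end≡ → 0≢suc (trans (sym returns) end≡))) ⟩
  eₖ + eₖ₊₁ + 0 + 0                                         ≡⟨ cong (_+ 0) (ℕP.+-identityʳ _) ⟩
  eₖ + eₖ₊₁ + 0                                             ≡⟨ ℕP.+-identityʳ _ ⟩
  eₖ + eₖ₊₁                                                 ∎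
  where
  eₖ = crossings (+ k) (+ 0) p
  eₖ₊₁ = crossings (+ suc k) (+ 0) p
  0≢suc : + 0 ≢ + suc k
  0≢suc ()

-- T I k = S I k - (-1)^k.  For the frame of a Dyck path it is half the number
-- of steps between heights k and k + 1 (T-halves-crossings).
T : (ℕ → ℕ) → ℕ → ℤ
T I zero    = + I 0 ℤ.- + 1
T I (suc k) = + I (suc k) ℤ.- T I k

halve-step : ∀ x t y z → + 2 ℤ.* x ≡ y ℤ.+ z → + 2 ℤ.* t ≡ y → + 2 ℤ.* (x ℤ.- t) ≡ z
halve-step x t y z 2x≡y+z 2t≡y = begin
  + 2 ℤ.* (x ℤ.- t)               ≡⟨ distrib x t ⟩
  + 2 ℤ.* x ℤ.- + 2 ℤ.* t         ≡⟨ cong₂ ℤ._-_ 2x≡y+z 2t≡y ⟩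
  (y ℤ.+ z) ℤ.- y                 ≡⟨ cancel y z ⟩
  z                               ∎
  where
  distrib : ∀ x t → + 2 ℤ.* (x ℤ.- t) ≡ + 2 ℤ.* x ℤ.- + 2 ℤ.* t
  distrib = ℤSolver.solve-∀
  cancel : ∀ y z → (y ℤ.+ z) ℤ.- y ≡ z
  cancel = ℤSolver.solve-∀

2*≡+-in-ℤ : ∀ a b c → 2 * a ≡ b + c → + 2 ℤ.* + a ≡ + b ℤ.+ + c
2*≡+-in-ℤ a b c eq = trans (sym (ℤP.pos-* 2 a)) (trans (cong +_ eq) (ℤP.pos-+ b c))

T-halves-crossings : ∀ (I e : ℕ → ℕ) → 2 * I 0 ≡ 2 + e 0 → (∀ k → 2 * I (suc k) ≡ e k + e (suc k)) →
  ∀ k → + 2 ℤ.* T I k ≡ + e k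
T-halves-crossings I e rel₀ relₛ zero =
  halve-step (+ I 0) (+ 1) (+ 2) (+ e 0) (2*≡+-in-ℤ (I 0) 2 (e 0) rel₀) refl
T-halves-crossings I e rel₀ relₛ (suc k) =
  halve-step (+ I (suc k)) (T I k) (+ e k) (+ e (suc k)) (2*≡+-in-ℤ (I (suc k)) (e k) (e (suc k)) (relₛ k))
    (T-halves-crossings I e rel₀ relₛ k)

-- A sequence is recovered from T: I₀ = T₀ + 1 and I_{k+1} = T_{k+1} + T_k.
T-injective : ∀ (I J : ℕ → ℕ) → (∀ k → T I k ≡ T J k) → ∀ k → I k ≡ J k
T-injective I J T≡ zero = ℤP.+-injective (begin
  + I 0                   ≡⟨ sym (sub-+-cancel (+ I 0) (+ 1)) ⟩
  T I 0 ℤ.+ + 1           ≡⟨ cong (ℤ._+ + 1) (T≡ 0) ⟩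
  T J 0 ℤ.+ + 1           ≡⟨ sub-+-cancel (+ J 0) (+ 1) ⟩
  + J 0                   ∎)
T-injective I J T≡ (suc k) = ℤP.+-injective (begin
  + I (suc k)                    ≡⟨ sym (sub-+-cancel (+ I (suc k)) (T I k)) ⟩
  T I (suc k) ℤ.+ T I k          ≡⟨ cong₂ ℤ._+_ (T≡ (suc k)) (T≡ k) ⟩
  T J (suc k) ℤ.+ T J k          ≡⟨ sub-+-cancel (+ J (suc k)) (T J k) ⟩
  + J (suc k)                    ∎)

half-positive : ∀ {t e} → + 2 ℤ.* t ≡ + e → 1 ≤ e → + 1 ℤ.≤ t
half-positive {+ zero}    refl ()
half-positive {+ suc n}   _    _ = ℤ.+≤+ (s≤s z≤n)
half-positive { -[1+ n ]} ()   _

TCondition : (ℕ → ℕ) → ℕ → Set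
TCondition I f = (∀ k → k < f → + 1 ℤ.≤ T I k) × T I f ≡ + 0

frame⇒TCondition : ∀ I f → I f ≢ 0 → (∀ k → f < k → I k ≡ 0) → IsFrameOfDyck I → TCondition I f
frame⇒TCondition I f If≢0 I-vanishes (p , dyck , frame≡I) = positive , vanishes
  where
  e : ℕ → ℕ
  e k = crossings (+ k) (+ 0) p
  2T≡e : ∀ k → + 2 ℤ.* T I k ≡ + e k
  2T≡e = T-halves-crossings I e
    (subst (λ x → 2 * x ≡ 2 + e 0) (frame≡I 0) (dyck-frame-zero p dyck))
    (λ k → subst (λ x → 2 * x ≡ e k + e (suc k)) (frame≡I (suc k)) (dyck-frame-suc p dyck k))
  reaches-f : Any (_≡ + f) (heightsFrom (+ 0) p)
  reaches-f = countHeight-visited f _ (If≢0 ∘ trans (sym (frame≡I f)))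
  positive : ∀ k → k < f → + 1 ℤ.≤ T I k
  positive k k<f = half-positive (2T≡e k)
    (crossing-exists (+ k) (+ 0) p (ℤ.+≤+ z≤n)
      (Any.map (λ h≡f → subst (+ k ℤ.<_) (sym h≡f) (ℤ.+<+ k<f)) reaches-f))
  no-crossing-at-f : e f ≡ 0
  no-crossing-at-f = ℕP.m+n≡0⇒m≡0 (e f) (begin
    e f + e (suc f)    ≡⟨ sym (dyck-frame-suc p dyck f) ⟩
    2 * frame p (suc f) ≡⟨ cong (2 *_) (trans (frame≡I (suc f)) (I-vanishes (suc f) ℕP.≤-refl)) ⟩
    0                  ∎)
  vanishes : T I f ≡ + 0
  vanishes = ℤP.*-cancelˡ-≡ (+ 2) (T I f) (+ 0) (trans (2T≡e f) (cong +_ no-crossing-at-f))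

endHeight-++ : ∀ h p q → endHeight h (p ++ q) ≡ endHeight (endHeight h p) q
endHeight-++ h []           q = refl
endHeight-++ h (true  ∷ p) q = endHeight-++ (h ℤ.+ + 1) p q
endHeight-++ h (false ∷ p) q = endHeight-++ (h ℤ.- + 1) p q

All-heights-++ : ∀ {P : ℤ → Set} h p q → All P (heightsFrom h p) →
  All P (heightsFrom (endHeight h p) q) → All P (heightsFrom h (p ++ q))
All-heights-++ h []           q _          Pq = Pq
All-heights-++ h (true  ∷ p) q (Ph ∷ Pp) Pq = Ph ∷ All-heights-++ (h ℤ.+ + 1) p q Pp Pq
All-heights-++ h (false ∷ p) q (Ph ∷ Pp) Pq = Ph ∷ All-heights-++ (h ℤ.- + 1) p q Pp Pq

crossings-++ : ∀ z h p q → crossings z h (p ++ q) ≡ crossings z h p + crossings z (endHeight h p) q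
crossings-++ z h []           q = refl
crossings-++ z h (true  ∷ p) q =
  trans (cong (_+_ (δ h z)) (crossings-++ z (h ℤ.+ + 1) p q)) (sym (ℕP.+-assoc (δ h z) _ _))
crossings-++ z h (false ∷ p) q =
  trans (cong (_+_ (δ (h ℤ.- + 1) z)) (crossings-++ z (h ℤ.- + 1) p q)) (sym (ℕP.+-assoc (δ (h ℤ.- + 1) z) _ _))

oscillate : ℕ → List Step
oscillate zero    = []
oscillate (suc n) = true ∷ false ∷ oscillate n

endHeight-oscillate : ∀ h n → endHeight h (oscillate n) ≡ h
endHeight-oscillate h zero    = refl
endHeight-oscillate h (suc n) = trans (endHeight-oscillate _ n) (+-sub-cancel h (+ 1))

oscillate-above : ∀ h n → All (h ℤ.≤_) (heightsFrom h (oscillate n))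
oscillate-above h zero    = ℤP.≤-refl ∷ []
oscillate-above h (suc n) rewrite +-sub-cancel h (+ 1) =
  ℤP.≤-refl ∷ ℤP.i≤i+j h (+ 1) ∷ oscillate-above h n

crossings-oscillate : ∀ z h n → crossings z h (oscillate n) ≡ n * (2 * δ h z)
crossings-oscillate z h zero    = refl
crossings-oscillate z h (suc n) rewrite +-sub-cancel h (+ 1) | crossings-oscillate z h n =
  regroup (δ h z) n
  where
  regroup : ∀ d n → d + (d + n * (2 * d)) ≡ suc n * (2 * d)
  regroup = solve-∀

-- tower v k m, started at height k: climb to height k + m and, after each
-- descent to a height j on the way back, make v j extra round trips through
-- the strip [j, j+1].
tower : (ℕ → ℕ) → ℕ → ℕ → List Step
tower v k zero    = []
tower v k (suc m) = true ∷ (tower v (suc k) m ++ (false ∷ oscillate (v k)))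

endHeight-tower : ∀ v k m h → endHeight h (tower v k m) ≡ h
endHeight-tower v k zero    h = refl
endHeight-tower v k (suc m) h
  rewrite endHeight-++ (h ℤ.+ + 1) (tower v (suc k) m) (false ∷ oscillate (v k))
        | endHeight-tower v (suc k) m (h ℤ.+ + 1)
  = trans (endHeight-oscillate _ (v k)) (+-sub-cancel h (+ 1))

tower-above : ∀ v k m h → All (h ℤ.≤_) (heightsFrom h (tower v k m))
tower-above v k zero    h = ℤP.≤-refl ∷ []
tower-above v k (suc m) h = ℤP.≤-refl ∷ All-heights-++ (h ℤ.+ + 1) (tower v (suc k) m) _
  (All.map (ℤP.≤-trans h≤h+1) (tower-above v (suc k) m (h ℤ.+ + 1)))
  (subst (λ x → All (h ℤ.≤_) (heightsFrom x (false ∷ oscillate (v k))))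
     (sym (endHeight-tower v (suc k) m (h ℤ.+ + 1))) descent)
  where
  h≤h+1 : h ℤ.≤ h ℤ.+ + 1
  h≤h+1 = ℤP.i≤i+j h (+ 1)
  descent : All (h ℤ.≤_) (heightsFrom (h ℤ.+ + 1) (false ∷ oscillate (v k)))
  descent rewrite +-sub-cancel h (+ 1) = h≤h+1 ∷ oscillate-above h (v k)

crossings-tower-step : ∀ z v k m → crossings z (+ k) (tower v k (suc m)) ≡
  2 * suc (v k) * δ (+ k) z + crossings z (+ suc k) (tower v (suc k) m)
crossings-tower-step z v k m
  rewrite crossings-++ z (+ k ℤ.+ + 1) (tower v (suc k) m) (false ∷ oscillate (v k))
        | endHeight-tower v (suc k) m (+ k ℤ.+ + 1)
        | +-sub-cancel (+ k) (+ 1)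
        | crossings-oscillate z (+ k) (v k)
        | ℕP.+-comm k 1
  = regroup (δ (+ k) z) (crossings z (+ suc k) (tower v (suc k) m)) (v k)
  where
  regroup : ∀ d c n → d + (c + (d + n * (2 * d))) ≡ 2 * suc n * d + c
  regroup = solve-∀

crossings-tower-other : ∀ v k m j → k ≢ j →
  crossings (+ j) (+ k) (tower v k (suc m)) ≡ crossings (+ j) (+ suc k) (tower v (suc k) m)
crossings-tower-other v k m j k≢j = begin
  crossings (+ j) (+ k) (tower v k (suc m))                               ≡⟨ crossings-tower-step (+ j) v k m ⟩
  2 * suc (v k) * δ (+ k) (+ j) + crossings (+ j) (+ suc k) (tower v (suc k) m)
    ≡⟨ cong (λ x → 2 * suc (v k) * x + upper) (δ-≢ (k≢j ∘ ℤP.+-injective)) ⟩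
  2 * suc (v k) * 0 + upper
    ≡⟨ cong (_+ upper) (ℕP.*-zeroʳ (2 * suc (v k))) ⟩
  upper                                                                   ∎
  where
  upper = crossings (+ j) (+ suc k) (tower v (suc k) m)

crossings-tower-above : ∀ v k m j → k + m ≤ j → crossings (+ j) (+ k) (tower v k m) ≡ 0
crossings-tower-above v k zero    j _      = refl
crossings-tower-above v k (suc m) j top≤j =
  trans (crossings-tower-other v k m j (ℕP.<⇒≢ k<j))
        (crossings-tower-above v (suc k) m j (subst (_≤ j) (ℕP.+-suc k m) top≤j))
  where
  k<j : k < j
  k<j = ℕP.<-≤-trans (ℕP.m<m+n k (s≤s z≤n)) top≤j

crossings-tower-inside : ∀ v k m j → k ≤ j → j < k + m →
  crossings (+ j) (+ k) (tower v k m) ≡ 2 * suc (v j)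
crossings-tower-inside v k zero j k≤j j<k+0 =
  ⊥-elim (ℕP.<⇒≱ j<k+0 (subst (_≤ j) (sym (ℕP.+-identityʳ k)) k≤j))
crossings-tower-inside v k (suc m) j k≤j j<top with k ℕP.≟ j
... | yes refl = begin
  crossings (+ k) (+ k) (tower v k (suc m))                                 ≡⟨ crossings-tower-step (+ k) v k m ⟩
  2 * suc (v k) * δ (+ k) (+ k) + crossings (+ k) (+ suc k) (tower v (suc k) m)
    ≡⟨ cong₂ (λ x y → 2 * suc (v k) * x + y) (δ-≡ {+ k} refl) upper-part-avoids-k ⟩
  2 * suc (v k) * 1 + 0                                                     ≡⟨ regroup (v k) ⟩
  2 * suc (v k)                                                             ∎
  where
  upper-part-avoids-k : crossings (+ k) (+ suc k) (tower v (suc k) m) ≡ 0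
  upper-part-avoids-k = crossings-avoid (+ k) (+ suc k) (tower v (suc k) m)
    (All.map (λ { (ℤ.+≤+ k<x) refl → ℕP.<-irrefl refl k<x }) (tower-above v (suc k) m (+ suc k)))
  regroup : ∀ n → 2 * suc n * 1 + 0 ≡ 2 * suc n
  regroup = solve-∀
... | no k≢j = trans (crossings-tower-other v k m j k≢j)
  (crossings-tower-inside v (suc k) m j (ℕP.≤∧≢⇒< k≤j k≢j) (subst (j <_) (ℕP.+-suc k m) j<top))

T-vanishes-beyond : ∀ I f → (∀ k → f < k → I k ≡ 0) → T I f ≡ + 0 → ∀ j → f ≤ j → T I j ≡ + 0
T-vanishes-beyond I f I-vanishes T-top j f≤j =
  subst (λ x → T I x ≡ + 0) (ℕP.m∸n+n≡m f≤j) (above (j ∸ f))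
  where
  above : ∀ d → T I (d + f) ≡ + 0
  above zero    = T-top
  above (suc d) = cong₂ (λ a b → + a ℤ.- b) (I-vanishes (suc d + f) (s≤s (ℕP.m≤n+m f d))) (above d)

-- The number of extra round trips through a strip that must be crossed 2t times.
extraTrips : ℤ → ℕ
extraTrips t = pred ℤ.∣ t ∣

extraTrips-spec : ∀ {t} → + 1 ℤ.≤ t → + suc (extraTrips t) ≡ t
extraTrips-spec (ℤ.+≤+ (s≤s _)) = refl

-- Sufficiency: under TCondition the tower with extraTrips (T I j) round trips
-- through each strip j is a Dyck path whose crossing numbers are 2 T I j; as
-- the frame of a Dyck path is determined by its crossings, its frame is I.
TCondition⇒frame : ∀ I f → (∀ k → f < k → I k ≡ 0) → TCondition I f → IsFrameOfDyck I
TCondition⇒frame I f I-vanishes (positive , T-top) = P , dyck , frame≡I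
  where
  v : ℕ → ℕ
  v j = extraTrips (T I j)
  P : List Step
  P = tower v 0 f
  dyck : IsDyck P
  dyck = tower-above v 0 f (+ 0) , endHeight-tower v 0 f (+ 0)
  e : ℕ → ℕ
  e j = crossings (+ j) (+ 0) P
  2T≡e : ∀ j → + 2 ℤ.* T (frame P) j ≡ + e j
  2T≡e = T-halves-crossings (frame P) e (dyck-frame-zero P dyck) (dyck-frame-suc P dyck)
  P-crossings : ∀ j → + 2 ℤ.* T (frame P) j ≡ + 2 ℤ.* T I j
  P-crossings j with j ℕP.<? f
  ... | yes j<f = begin
    + 2 ℤ.* T (frame P) j  ≡⟨ 2T≡e j ⟩
    + e j                  ≡⟨ cong +_ (crossings-tower-inside v 0 f j z≤n j<f) ⟩
    + (2 * suc (v j))      ≡⟨ ℤP.pos-* 2 (suc (v j)) ⟩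
    + 2 ℤ.* + suc (v j)    ≡⟨ cong (+ 2 ℤ.*_) (extraTrips-spec (positive j j<f)) ⟩
    + 2 ℤ.* T I j          ∎
  ... | no j≮f = begin
    + 2 ℤ.* T (frame P) j  ≡⟨ 2T≡e j ⟩
    + e j                  ≡⟨ cong +_ (crossings-tower-above v 0 f j f≤j) ⟩
    + 0                    ≡⟨ cong (+ 2 ℤ.*_) (sym (T-vanishes-beyond I f I-vanishes T-top j f≤j)) ⟩
    + 2 ℤ.* T I j          ∎
    where
    f≤j : f ≤ j
    f≤j = ℕP.≮⇒≥ j≮f
  frame≡I : ∀ k → frame P k ≡ I k
  frame≡I = T-injective (frame P) I (λ j → ℤP.*-cancelˡ-≡ (+ 2) _ _ (P-crossings j))

sign : ℕ → ℤ
sign zero    = + 1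
sign (suc k) = ℤ.- sign k

S≡T+sign : ∀ I k → S I k ≡ T I k ℤ.+ sign k
S≡T+sign I zero    = sym (sub-+-cancel (+ I 0) (+ 1))
S≡T+sign I (suc k) = begin
  + I (suc k) ℤ.- S I k                      ≡⟨ cong (ℤ._-_ (+ I (suc k))) (S≡T+sign I k) ⟩
  + I (suc k) ℤ.- (T I k ℤ.+ sign k)         ≡⟨ regroup (+ I (suc k)) (T I k) (sign k) ⟩
  (+ I (suc k) ℤ.- T I k) ℤ.+ ℤ.- sign k     ∎
  where
  regroup : ∀ x t s → x ℤ.- (t ℤ.+ s) ≡ (x ℤ.- t) ℤ.+ ℤ.- s
  regroup = ℤSolver.solve-∀

sign-even : ∀ {k} → Even k → sign k ≡ + 1
sign-even (zero , refl)  = refl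
sign-even (suc m , refl) = begin
  sign (2 * suc m)          ≡⟨ cong sign (ℕP.*-suc 2 m) ⟩
  ℤ.- ℤ.- sign (2 * m)      ≡⟨ ℤP.neg-involutive (sign (2 * m)) ⟩
  sign (2 * m)              ≡⟨ sign-even (m , refl) ⟩
  + 1                       ∎

sign-odd : ∀ {k} → Odd k → sign k ≡ -[1+ 0 ]
sign-odd (m , refl) = cong ℤ.-_ (sign-even (m , refl))

S-even : ∀ I {k} → Even k → S I k ≡ T I k ℤ.+ + 1
S-even I {k} even = trans (S≡T+sign I k) (cong (ℤ._+_ (T I k)) (sign-even even))

S-odd : ∀ I {k} → Odd k → S I k ≡ T I k ℤ.+ -[1+ 0 ]
S-odd I {k} odd = trans (S≡T+sign I k) (cong (ℤ._+_ (T I k)) (sign-odd odd))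

parity : ∀ k → Even k ⊎ Odd k
parity zero    = inj₁ (0 , refl)
parity (suc k) with parity k
... | inj₁ (m , k≡2m)   = inj₂ (m , cong suc k≡2m)
... | inj₂ (m , k≡2m+1) = inj₁ (suc m , trans (cong suc k≡2m+1) (sym (ℕP.*-suc 2 m)))

interior⇔ : ∀ I k → (+ 1 ℤ.≤ T I k) ⇔
  ((Odd k → + 0 ℤ.≤ S I k) × (Even k → + 2 ℤ.≤ S I k))
interior⇔ I k = mk⇔
  (λ T≥1 → (λ odd → subst (+ 0 ℤ.≤_) (sym (S-odd I odd)) (to (+-shift-≤ -[1+ 0 ]) T≥1))
         , (λ even → subst (+ 2 ℤ.≤_) (sym (S-even I even)) (to (+-shift-≤ (+ 1)) T≥1)))
  (λ { (odd-bound , even-bound) → case-parity odd-bound even-bound (parity k) })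
  where
  case-parity : (Odd k → + 0 ℤ.≤ S I k) → (Even k → + 2 ℤ.≤ S I k) → Even k ⊎ Odd k → + 1 ℤ.≤ T I k
  case-parity _ even-bound (inj₁ even) = from (+-shift-≤ (+ 1)) (subst (+ 2 ℤ.≤_) (S-even I even) (even-bound even))
  case-parity odd-bound _ (inj₂ odd)   = from (+-shift-≤ -[1+ 0 ]) (subst (+ 0 ℤ.≤_) (S-odd I odd) (odd-bound odd))

top⇔ : ∀ I f → (T I f ≡ + 0) ⇔ ((Odd f → S I f ≡ -[1+ 0 ]) × (Even f → S I f ≡ + 1))
top⇔ I f = mk⇔
  (λ T≡0 → (λ odd → trans (S-odd I odd) (to (+-shift-≡ -[1+ 0 ]) T≡0))
         , (λ even → trans (S-even I even) (to (+-shift-≡ (+ 1)) T≡0)))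
  (λ { (odd-value , even-value) → case-parity odd-value even-value (parity f) })
  where
  case-parity : (Odd f → S I f ≡ -[1+ 0 ]) → (Even f → S I f ≡ + 1) → Even f ⊎ Odd f → T I f ≡ + 0
  case-parity _ even-value (inj₁ even) = from (+-shift-≡ (+ 1)) (trans (sym (S-even I even)) (even-value even))
  case-parity odd-value _ (inj₂ odd)   = from (+-shift-≡ -[1+ 0 ]) (trans (sym (S-odd I odd)) (odd-value odd))

FrameConditions : (ℕ → ℕ) → ℕ → Set
FrameConditions I f =
  ((f ≡ 0 → I 0 ≡ 1) × (0 < f → 2 ≤ I 0))
  × (∀ k → 1 ≤ k → suc k ≤ f → (Odd k → + 0 ℤ.≤ S I k) × (Even k → + 2 ℤ.≤ S I k))
  × ((Odd f → S I f ≡ -[1+ 0 ]) × (Even f → S I f ≡ + 1))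

-- Conditions (i)-(iii) are TCondition; (i) is (ii) at level 0 resp. (iii) when f = 0.
FrameConditions⇔TCondition : ∀ I f → FrameConditions I f ⇔ TCondition I f
FrameConditions⇔TCondition I f = mk⇔
  (λ { ((_ , I₀≥2) , interior , top) →
         (λ { zero 0<f    → to (+-shift-≤ -[1+ 0 ]) (ℤ.+≤+ (I₀≥2 0<f))
            ; (suc k) k<f → from (interior⇔ I (suc k)) (interior (suc k) (s≤s z≤n) k<f) })
       , from (top⇔ I f) top })
  (λ { (positive , vanishes) →
         ( (λ { refl → ℤP.+-injective (proj₂ (to (top⇔ I 0) vanishes) (0 , refl)) })
         , (λ 0<f → ℤP.drop‿+≤+ (proj₂ (to (interior⇔ I 0) (positive 0 0<f)) (0 , refl))) )
       , (λ k _ k<f → to (interior⇔ I k) (positive k k<f))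
       , to (top⇔ I f) vanishes })

-- Theorem 7.
mainTheorem7 : (I : ℕ → ℕ) (f n : ℕ) →
    I f ≢ 0 → (∀ k → f < k → I k ≡ 0) → sumUpTo I f ≡ suc (2 * n) →
    (IsFrameOfDyck I ⇔
      (((f ≡ 0 → I 0 ≡ 1) × (0 < f → 2 ≤ I 0))
      × (∀ k → 1 ≤ k → suc k ≤ f →
           (Odd k → (+ 0) Data.Integer.≤ S I k) × (Even k → (+ 2) Data.Integer.≤ S I k))
      × ((Odd f → S I f ≡ -[1+ 0 ]) × (Even f → S I f ≡ + 1))))
mainTheorem7 I f _ If≢0 I-vanishes _ = mk⇔
  (λ isFrame → from (FrameConditions⇔TCondition I f) (frame⇒TCondition I f If≢0 I-vanishes isFrame))
  (λ conditions → TCondition⇒frame I f I-vanishes (to (FrameConditions⇔TCondition I f) conditions))
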